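{- Let $k\ge 3$ be odd and let $H$ be a Kimura Hadamard matrix of order $8k+4$. Then $(-I_{8k+4},-I_{8k+4})\in\mathrm{Aut}(H)$. Moreover, let $P_1,P_2$ be the $4\times4$ permutation matrices of the permutations $(1,2)(3,4)$ and $(1,3)(2,4)$, and put \[ \begin{aligned} R_1&=\mathrm{diag}\big(\mathrm{bdiag}(-1,1,-1,1),\ (\mathrm{diag}(-1,1,-1,1)P_1)\otimes I_{2k}\big),\\ S_1&=\mathrm{diag}\big(\mathrm{diag}(1,-1,-1,1)P_2,\ (\mathrm{diag}(-1,1,1,-1)P_1)\otimes I_{2k}\big),\\ R_2&=\mathrm{diag}\big(\mathrm{diag}(-1,1,1,-1)P_1,\ (\mathrm{diag}(1,-1,-1,1)P_2)\otimes I_{2k}\big),\\ S_2&=\mathrm{diag}\big(\mathrm{bdiag}(1,1,-1,-1),\ (\mathrm{diag}(1,1,-1,-1)P_2)\otimes I_{2k}\big). \end{aligned} \] Then $\sigma_3=(R_1,S_1)$ and $\sigma_4=(R_2,S_2)$ are automorphisms of $H$ of order $4$, and $\langle\sigma_3,\sigma_4\rangle$ is a subgroup of $\mathrm{Aut}(H)$ isomorphic to the quaternion group $Q_8$.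
   Context: Let $k\geq 3$ be odd. $D_{2k}=\langle x,y\mid x^k=1,\ y^2=1,\ y^{ -1}xy=x^{ -1}\rangle$, with elements listed in the order $x^0,\dots,x^{k-1},y,xy,\dots,x^{k-1}y$, which indexes rows and columns of $2k\times2k$ matrices. $\rho(g)=[\delta_{ug,v}]_{u,v}$ is the right regular matrix representation, extended linearly to $\mathbb{Z}D_{2k}$; for $w\in\mathbb{Z}D_{2k}$ with coefficients in $\{0,1\}$ its associated $\pm1$-matrix is $2\rho(w)-J_{2k}$. A Kimura Hadamard matrix of order $8k+4$ is a matrix \[ H=\begin{bmatrix} 1& 1 & 1 & 1 & \mathbf{1} & \mathbf{1} & \mathbf{1} & \mathbf{1}\\ 1& 1 & -1 & -1 & \mathbf{1} & \mathbf{1} & -\mathbf{1} & -\mathbf{1}\\ 1& -1 & 1 & -1 & \mathbf{1} & -\mathbf{1} & \mathbf{1} & -\mathbf{1}\\ 1& -1 & -1 & 1 & -\mathbf{1} & \mathbf{1} & \mathbf{1} & -\mathbf{1}\\ \mathbf{1}^\intercal & \mathbf{1}^\intercal & \mathbf{1}^\intercal & -\mathbf{1}^\intercal & A & B& C & D\\ \mathbf{1}^\intercal & \mathbf{1}^\intercal& -\mathbf{1}^\intercal & \mathbf{1}^\intercal & -B & A & D & -C\\ \mathbf{1}^\intercal & -\mathbf{1}^\intercal& \mathbf{1}^\intercal & \mathbf{1}^\intercal & -C & -D & A & B\\ \mathbf{1}^\intercal & -\mathbf{1}^\intercal& -\mathbf{1}^\intercal & -\mathbf{1}^\intercal & D &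 -C & B & -A \end{bmatrix} \] ($\mathbf 1$ the all-ones row vector of length $2k$) with $HH^\intercal=(8k+4)I_{8k+4}$, where $A,B,C,D$ are the $\pm1$-matrices associated to some $a,b,c,d\in\mathbb{Z}D_{2k}$ with coefficients in $\{0,1\}$. With $\mathrm{Mon}_n(\{\pm1\})$ the group of $n\times n$ signed permutation matrices, $\mathrm{Aut}(H)=\{(R,S)\in\mathrm{Mon}_{8k+4}(\{\pm1\})^2: RHS^\intercal=H\}$ under componentwise multiplication. $\mathrm{diag}(Y_1,\dots,Y_n)$ is the block diagonal matrix and $\mathrm{bdiag}(Y_1,\dots,Y_n)$ the block anti-diagonal matrix with $Y_1,\dots,Y_n$ placed from top right to bottom left; $\otimes$ is the Kronecker product. -}

module Defs where

open import Data.Nat as ℕ using (ℕ; zero; suc; _<_)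
open import Data.Nat.DivMod using (_%_; m%n<n)
open import Data.Integer as ℤ using (ℤ; +_; -_; _*_; _+_; _-_)
open import Data.Fin as F using (Fin; zero; suc; toℕ; fromℕ<; splitAt; remQuot)
open import Data.Fin.Permutation using (Permutation′; _⟨$⟩ʳ_)
open import Data.Sign as Sign using (Sign)
open import Data.Bool using (Bool; true; false; if_then_else_; _∧_)
open import Data.Product using (Σ; ∃; ∃₂; _×_; _,_; proj₁; proj₂)
open import Data.Sum using (_⊎_; inj₁; inj₂)
open import Data.Vec using (Vec; lookup; _∷_; [])
open import Relation.Binary.PropositionalEquality using (_≡_)
open import Relation.Nullary using (¬_; does)

Odd : ℕ → Set
Odd k = ∃ λ m → k ≡ suc (2 ℕ.* m)

Σℤ : ∀ {n} → (Fin n → ℤ) → ℤ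
Σℤ {zero}  f = + 0
Σℤ {suc n} f = f zero + Σℤ (λ i → f (suc i))

Mat : ℕ → Set
Mat n = Fin n → Fin n → ℤ

δ : ∀ {n} → Fin n → Fin n → ℤ
δ i j = if does (i F.≟ j) then + 1 else + 0

infixl 7 _·_
_·_ : ∀ {n} → Mat n → Mat n → Mat n
(M · N) i j = Σℤ (λ l → M i l * N l j)

_ᵀ : ∀ {n} → Mat n → Mat n
(M ᵀ) i j = M j i

Id : ∀ n → Mat n
Id n = δ

_∙ₛ_ : ∀ {n} → ℤ → Mat n → Mat n
(c ∙ₛ M) i j = c * M i j

negM : ∀ {n} → Mat n → Mat n
negM M i j = - M i j

infix 4 _≋_
_≋_ : ∀ {n} → Mat n → Mat n → Set
M ≋ N = ∀ i j → M i j ≡ N i j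

diag2 : ∀ {a b} → Mat a → Mat b → Mat (a ℕ.+ b)
diag2 {a} X Y i j with splitAt a i | splitAt a j
... | inj₁ p | inj₁ q = X p q
... | inj₂ p | inj₂ q = Y p q
... | inj₁ _ | inj₂ _ = + 0
... | inj₂ _ | inj₁ _ = + 0

-- Kronecker product X ⊗ Y (block index major, as in the usual convention)
_⊗_ : ∀ {m p} → Mat m → Mat p → Mat (m ℕ.* p)
(_⊗_ {m} {p} X Y) i j with remQuot {m} p i | remQuot {m} p j
... | (i₁ , i₂) | (j₁ , j₂) = X i₁ j₁ * Y i₂ j₂

mat4 : Vec (Vec ℤ 4) 4 → Mat 4
mat4 v i j = lookup (lookup v i) j

p1 m1 : ℤ
p1 = + 1
m1 = - (+ 1)

diag4 : ℤ → ℤ → ℤ → ℤ → Mat 4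
diag4 d₀ d₁ d₂ d₃ i j = lookup (d₀ ∷ d₁ ∷ d₂ ∷ d₃ ∷ []) i * δ i j

-- bdiag(d₀,d₁,d₂,d₃): block anti-diagonal, d₀ top right ... d₃ bottom left
bdiag4 : ℤ → ℤ → ℤ → ℤ → Mat 4
bdiag4 d₀ d₁ d₂ d₃ i j = lookup (d₀ ∷ d₁ ∷ d₂ ∷ d₃ ∷ []) i * δ (F.opposite i) j

permMat : ∀ {n} → (Fin n → Fin n) → Mat n
permMat f i j = δ (f i) j

-- (1,2)(3,4) and (1,3)(2,4) on {1,2,3,4}, written 0-based on Fin 4
perm₁ perm₂ : Fin 4 → Fin 4
perm₁ i = lookup (F.suc F.zero ∷ F.zero ∷ F.fromℕ 3 ∷ F.inject₁ (F.fromℕ 2) ∷ []) i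
perm₂ i = lookup (F.inject₁ (F.fromℕ 2) ∷ F.fromℕ 3 ∷ F.zero ∷ F.suc F.zero ∷ []) i

P₁ P₂ : Mat 4
P₁ = permMat perm₁
P₂ = permMat perm₂

-- The dihedral group D_{2k}: the pair (e , j) stands for x^j y^e

Dih : ℕ → Set
Dih k = Fin 2 × Fin k

addMod : ∀ {k} → Fin k → Fin k → Fin k
addMod {suc n} i j = fromℕ< (m%n<n (toℕ i ℕ.+ toℕ j) (suc n))

negMod : ∀ {k} → Fin k → Fin k
negMod {suc n} i = fromℕ< (m%n<n (suc n ℕ.∸ toℕ i) (suc n))

flip2 : Fin 2 → Fin 2
flip2 zero = suc zero
flip2 (suc _) = zero

-- x^{j₁} y^{e₁} · x^{j₂} y^{e₂} = x^{j₁ + (-1)^{e₁} j₂} y^{e₁+e₂}   (since y x y⁻¹ = x⁻¹)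
infixl 7 _∙D_
_∙D_ : ∀ {k} → Dih k → Dih k → Dih k
(zero  , j₁) ∙D (e₂ , j₂) = e₂ , addMod j₁ j₂
(suc _ , j₁) ∙D (e₂ , j₂) = flip2 e₂ , addMod j₁ (negMod j₂)

δD : ∀ {k} → Dih k → Dih k → ℤ
δD (e , j) (e′ , j′) = if does (e F.≟ e′) ∧ does (j F.≟ j′) then + 1 else + 0

-- the listing x^0,…,x^{k-1},y,xy,…,x^{k-1}y : position i ↦ element
elt : ∀ k → Fin (2 ℕ.* k) → Dih k
elt k i = remQuot {2} k i

-- a group ring element of Z D_{2k} with coefficients in {0,1}
coef : Bool → ℤ
coef true  = + 1
coef false = + 0

-- right regular representation ρ(w) = Σ_g w_g ρ(g),  ρ(g)_{u,v} = δ_{ug,v}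
ρ : ∀ k → (Dih k → Bool) → Mat (2 ℕ.* k)
ρ k w u v = Σℤ (λ g → coef (w (elt k g)) * δD (elt k u ∙D elt k g) (elt k v))

pmMat : ∀ k → (Dih k → Bool) → Mat (2 ℕ.* k)
pmMat k w u v = (+ 2) * ρ k w u v - + 1

-- Kimura matrix of order 8k+4 (indexed by Fin (4 + 4·(2k)), with 4 + 4·2k = 8k+4)

ord : ℕ → ℕ
ord k = 4 ℕ.+ 4 ℕ.* (2 ℕ.* k)

decode : ∀ k → Fin (ord k) → Fin 4 ⊎ (Fin 4 × Fin (2 ℕ.* k))
decode k i with splitAt 4 i
... | inj₁ p = inj₁ p
... | inj₂ q = inj₂ (remQuot {4} (2 ℕ.* k) q)

Tkim : Mat 4
Tkim = mat4 ((p1 ∷ p1 ∷ p1 ∷ p1 ∷ []) ∷ (p1 ∷ p1 ∷ m1 ∷ m1 ∷ []) ∷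
             (p1 ∷ m1 ∷ p1 ∷ m1 ∷ []) ∷ (p1 ∷ m1 ∷ m1 ∷ p1 ∷ []) ∷ [])

-- signs of the all-ones row vectors in the first four rows
Ukim : Mat 4
Ukim = mat4 ((p1 ∷ p1 ∷ p1 ∷ p1 ∷ []) ∷ (p1 ∷ p1 ∷ m1 ∷ m1 ∷ []) ∷
             (p1 ∷ m1 ∷ p1 ∷ m1 ∷ []) ∷ (m1 ∷ p1 ∷ p1 ∷ m1 ∷ []) ∷ [])

-- signs of the all-ones column vectors in the first four columns
Vkim : Mat 4
Vkim = mat4 ((p1 ∷ p1 ∷ p1 ∷ m1 ∷ []) ∷ (p1 ∷ p1 ∷ m1 ∷ p1 ∷ []) ∷
             (p1 ∷ m1 ∷ p1 ∷ p1 ∷ []) ∷ (p1 ∷ m1 ∷ m1 ∷ m1 ∷ []) ∷ [])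

-- the 4×4 array of blocks  A B C D / −B A D −C / −C −D A B / D −C B −A
-- letters 0,1,2,3 = A,B,C,D
f0 f1 f2 f3 : Fin 4
f0 = F.zero
f1 = F.suc F.zero
f2 = F.suc (F.suc F.zero)
f3 = F.suc (F.suc (F.suc F.zero))

blkLetter : Vec (Vec (Fin 4) 4) 4
blkLetter = (f0 ∷ f1 ∷ f2 ∷ f3 ∷ []) ∷ (f1 ∷ f0 ∷ f3 ∷ f2 ∷ []) ∷
            (f2 ∷ f3 ∷ f0 ∷ f1 ∷ []) ∷ (f3 ∷ f2 ∷ f1 ∷ f0 ∷ []) ∷ []

blkSign : Mat 4
blkSign = mat4 ((p1 ∷ p1 ∷ p1 ∷ p1 ∷ []) ∷ (m1 ∷ p1 ∷ p1 ∷ m1 ∷ []) ∷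
                (m1 ∷ m1 ∷ p1 ∷ p1 ∷ []) ∷ (p1 ∷ m1 ∷ p1 ∷ m1 ∷ []) ∷ [])

kimura : ∀ k → (a b c d : Dih k → Bool) → Mat (ord k)
kimura k a b c d i j = go (decode k i) (decode k j)
  where
  blocks : Vec (Mat (2 ℕ.* k)) 4
  blocks = pmMat k a ∷ pmMat k b ∷ pmMat k c ∷ pmMat k d ∷ []
  go : Fin 4 ⊎ (Fin 4 × Fin (2 ℕ.* k)) → Fin 4 ⊎ (Fin 4 × Fin (2 ℕ.* k)) → ℤ
  go (inj₁ p)       (inj₁ q)       = Tkim p q
  go (inj₁ p)       (inj₂ (q , _)) = Ukim p q
  go (inj₂ (p , _)) (inj₁ q)       = Vkim p q
  go (inj₂ (p , u)) (inj₂ (q , v)) =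
    blkSign p q * lookup blocks (lookup (lookup blkLetter p) q) u v

IsHadamardOrder : ∀ k → Mat (ord k) → Set
IsHadamardOrder k H = H · H ᵀ ≋ (+ (8 ℕ.* k ℕ.+ 4)) ∙ₛ Id (ord k)

signℤ : Sign → ℤ
signℤ s = s ℤ.◃ 1

IsSignedPerm : ∀ {n} → Mat n → Set
IsSignedPerm {n} M =
  Σ (Permutation′ n) λ π → Σ (Fin n → Sign) λ s →
    ∀ i j → M i j ≡ signℤ (s i) * δ (π ⟨$⟩ʳ i) j

MPair : ℕ → Set
MPair n = Mat n × Mat n

infix 4 _≈P_
_≈P_ : ∀ {n} → MPair n → MPair n → Set
(R , S) ≈P (R′ , S′) = (R ≋ R′) × (S ≋ S′)

infixl 7 _⊙_
_⊙_ : ∀ {n} → MPair n → MPair n → MPair n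
(R , S) ⊙ (R′ , S′) = (R · R′) , (S · S′)

εP : ∀ n → MPair n
εP n = Id n , Id n

_^P_ : ∀ {n} → MPair n → ℕ → MPair n
_^P_ {n} σ zero = εP n
σ ^P suc m = σ ⊙ (σ ^P m)

InAut : ∀ {n} → Mat n → MPair n → Set
InAut H (R , S) = IsSignedPerm R × IsSignedPerm S × (R · H · S ᵀ ≋ H)

HasOrder : ∀ {n} → MPair n → ℕ → Set
HasOrder {n} σ m = (σ ^P m ≈P εP n) × (∀ j → 0 < j → j < m → ¬ (σ ^P j ≈P εP n))

data Gen {n} (g₁ g₂ : MPair n) : MPair n → Set where
  gen-ε   : Gen g₁ g₂ (εP n)
  gen-g₁  : Gen g₁ g₂ g₁
  gen-g₂  : Gen g₁ g₂ g₂
  gen-mul : ∀ {x y} → Gen g₁ g₂ x → Gen g₁ g₂ y → Gen g₁ g₂ (x ⊙ y)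
  gen-inv : ∀ {x y} → Gen g₁ g₂ x → x ⊙ y ≈P εP n → Gen g₁ g₂ y
  gen-resp : ∀ {x y} → Gen g₁ g₂ x → x ≈P y → Gen g₁ g₂ y

data QBasis : Set where
  q1 qi qj qk : QBasis

mulBasis : QBasis → QBasis → Sign × QBasis
mulBasis q1 q = Sign.+ , q
mulBasis q q1 = Sign.+ , q
mulBasis qi qi = Sign.- , q1
mulBasis qi qj = Sign.+ , qk
mulBasis qi qk = Sign.- , qj
mulBasis qj qi = Sign.- , qk
mulBasis qj qj = Sign.- , q1
mulBasis qj qk = Sign.+ , qi
mulBasis qk qi = Sign.+ , qj
mulBasis qk qj = Sign.- , qi
mulBasis qk qk = Sign.- , q1

Q₈ : Set
Q₈ = Sign × QBasis

_*Q_ : Q₈ → Q₈ → Q₈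
(s , p) *Q (t , q) = (s Sign.* t Sign.* proj₁ (mulBasis p q)) , proj₂ (mulBasis p q)

-- the subgroup ⟨g₁,g₂⟩ is isomorphic to Q₈: an injective homomorphism Q₈ → pairs
-- whose image is exactly ⟨g₁,g₂⟩
GenIsoQ₈ : ∀ {n} → MPair n → MPair n → Set
GenIsoQ₈ g₁ g₂ =
  Σ (Q₈ → MPair _) λ φ →
    (∀ x y → φ (x *Q y) ≈P φ x ⊙ φ y) ×
    (∀ x y → φ x ≈P φ y → x ≡ y) ×
    (∀ x → Gen g₁ g₂ (φ x)) ×
    (∀ z → Gen g₁ g₂ z → ∃ λ x → φ x ≈P z)

blockAut : ∀ k → Mat 4 → Mat 4 → Mat (ord k)
blockAut k X Y = diag2 X (Y ⊗ Id (2 ℕ.* k))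

R₁ S₁ R₂ S₂ : ∀ k → Mat (ord k)
R₁ k = blockAut k (bdiag4 m1 p1 m1 p1) (diag4 m1 p1 m1 p1 · P₁)
S₁ k = blockAut k (diag4 p1 m1 m1 p1 · P₂) (diag4 m1 p1 p1 m1 · P₁)
R₂ k = blockAut k (diag4 m1 p1 p1 m1 · P₁) (diag4 p1 m1 m1 p1 · P₂)
S₂ k = blockAut k (bdiag4 p1 p1 m1 m1) (diag4 p1 p1 m1 m1 · P₂)

σ₃ σ₄ : ∀ k → MPair (ord k)
σ₃ k = R₁ k , S₁ k
σ₄ k = R₂ k , S₂ k

negIPair : ∀ k → MPair (ord k)
negIPair k = negM (Id (ord k)) , negM (Id (ord k))

module Submission where

-- All matrices in the statement are block signed permutations: a signed permutation of the four
-- header indices together with a signed permutation of the four block rows (or columns), acting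
-- trivially inside each 2k × 2k block.  Since such a pair (R , S) carries every block of H along
-- unchanged, R H Sᵀ = H holds as soon as (R , S) preserves the 4 × 4 data of the Kimura pattern:
-- the signs in the header, in the borders and in front of the blocks, and the letters A, B, C, D.  The block signed permutations ψ(x), x ∈ Q₈, with
-- ψ(i), ψ(j) the two automorphisms σ₃, σ₄ and ψ(-1) = (-I , -I), form a faithful representation of
-- Q₈ all of whose elements preserve the pattern.  Hence ⟨σ₃ , σ₄⟩ is exactly its image, which
-- gives the orders, the containment in Aut(H) and the isomorphism with Q₈.

open import Defs
open import Data.Nat using (ℕ; _≤_)
open import Data.Bool using (Bool)
open import Data.Product using (_×_)
open import Data.Bool using (if_then_else_)
open import Data.Nat as ℕ using (zero; suc; _<_; s≤s)
open import Data.Integer as ℤ using (ℤ; +_; _+_; _*_)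
import Data.Integer.Properties as ℤ
open import Data.Integer.Tactic.RingSolver using (solve-∀)
open import Data.Fin as F using (Fin; zero; suc; _↑ˡ_; _↑ʳ_; combine; splitAt)
import Data.Fin.Properties as F
open import Data.Fin.Permutation using (permutation)
open import Data.Sign as Sign using (Sign)
import Data.Sign.Properties as Sign
open import Data.Product as Product using (∃; _,_; proj₁; proj₂)
import Data.Product.Properties as Product
open import Data.Sum using (_⊎_; inj₁; inj₂)
open import Data.Vec as Vec using (Vec; lookup; tabulate; _∷_; [])
import Data.Vec.Properties as Vec
open import Function using (_∘_)
open import Function.Bundles using (mk⇔)
open import Level using (0ℓ)
open import Relation.Binary.Bundles using (Setoid)
open import Relation.Binary.Definitions using (DecidableEquality)
open import Relation.Binary.PropositionalEquality
import Relation.Binary.Reasoning.Setoid as SetoidReasoning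
open import Relation.Nullary using (Dec; yes; no)
open import Relation.Nullary.Decidable
  using (True; toWitness; map′; _×-dec_; _→-dec_; dec-false; does-⇔)

Σℤ-cong : ∀ {n} {f g : Fin n → ℤ} → (∀ i → f i ≡ g i) → Σℤ f ≡ Σℤ g
Σℤ-cong {zero}  f≗g = refl
Σℤ-cong {suc n} f≗g = cong₂ _+_ (f≗g zero) (Σℤ-cong (f≗g ∘ suc))

Σℤ-*ˡ : ∀ {n} c (f : Fin n → ℤ) → Σℤ (λ l → c * f l) ≡ c * Σℤ f
Σℤ-*ˡ {zero}  c f = sym (ℤ.*-zeroʳ c)
Σℤ-*ˡ {suc n} c f =
  trans (cong (_+_ (c * f zero)) (Σℤ-*ˡ c (f ∘ suc))) (sym (ℤ.*-distribˡ-+ c (f zero) _))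

Σℤ-zero : ∀ n → Σℤ {n} (λ _ → + 0) ≡ + 0
Σℤ-zero zero    = refl
Σℤ-zero (suc n) = trans (ℤ.+-identityˡ _) (Σℤ-zero n)

Σℤ-δ : ∀ {n} (p : Fin n) (f : Fin n → ℤ) → Σℤ (λ l → δ p l * f l) ≡ f p
Σℤ-δ {suc n} zero    f =
  trans (cong₂ _+_ (ℤ.*-identityˡ (f zero)) (Σℤ-zero n)) (ℤ.+-identityʳ (f zero))
Σℤ-δ         (suc p) f = trans (ℤ.+-identityˡ _) (Σℤ-δ p (f ∘ suc))

δ-≢ : ∀ {n} {i j : Fin n} → i ≢ j → δ i j ≡ + 0
δ-≢ {i = i} {j} i≢j = cong (if_then + 1 else + 0) (dec-false (i F.≟ j) i≢j)

δ-injective : ∀ {m n} (f : Fin m → Fin n) → (∀ {i j} → f i ≡ f j → i ≡ j) →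
              ∀ i j → δ (f i) (f j) ≡ δ i j
δ-injective f inj i j =
  cong (if_then + 1 else + 0) (does-⇔ (mk⇔ inj (cong f)) (f i F.≟ f j) (i F.≟ j))

δ-↑ˡ-↑ʳ : ∀ {m n} (i : Fin m) (j : Fin n) → δ (i ↑ˡ n) (m ↑ʳ j) ≡ + 0
δ-↑ˡ-↑ʳ zero    j = refl
δ-↑ˡ-↑ʳ (suc i) j = δ-↑ˡ-↑ʳ i j

δ-↑ʳ-↑ˡ : ∀ {m n} (i : Fin m) (j : Fin n) → δ (m ↑ʳ j) (i ↑ˡ n) ≡ + 0
δ-↑ʳ-↑ˡ zero    j = refl
δ-↑ʳ-↑ˡ (suc i) j = δ-↑ʳ-↑ˡ i j

δ-combine : ∀ {m n} (i k : Fin m) (j l : Fin n) →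
            δ (combine i j) (combine k l) ≡ δ i k * δ j l
δ-combine i k j l with i F.≟ k
... | yes refl = trans (δ-injective (combine i) (F.combine-injectiveʳ i _ i _) j l)
                       (sym (ℤ.*-identityˡ (δ j l)))
... | no i≢k   = δ-≢ (i≢k ∘ F.combine-injectiveˡ i j k l)

signℤ-* : ∀ s t → signℤ (s Sign.* t) ≡ signℤ s * signℤ t
signℤ-* s t = ℤ.◃-distrib-* s t 1 1

signℤ-cancelˡ : ∀ s {x y} → signℤ s * x ≡ signℤ s * y → x ≡ y
signℤ-cancelˡ s = ℤ.*-cancelˡ-≡ (signℤ s) _ _ {{ℤ.◃-nonZero s 1}}

SignedMap : Set → Set
SignedMap I = I → Sign × I

infixl 9 _⨟_
_⨟_ : ∀ {I} → SignedMap I → SignedMap I → SignedMap I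
(f ⨟ g) i = proj₁ (f i) Sign.* proj₁ (g (proj₂ (f i))) , proj₂ (g (proj₂ (f i)))

Invariant : ∀ {I} → (I → I → ℤ) → SignedMap I → SignedMap I → Set
Invariant H f g =
  ∀ i j → signℤ (proj₁ (f i)) * H (proj₂ (f i)) (proj₂ (g j)) * signℤ (proj₁ (g j)) ≡ H i j

signedPerm : ∀ {n} → SignedMap (Fin n) → Mat n
signedPerm f i j = signℤ (proj₁ (f i)) * δ (proj₂ (f i)) j

signedPerm-cong : ∀ {n} {f g : SignedMap (Fin n)} → (∀ i → f i ≡ g i) →
                  signedPerm f ≋ signedPerm g
signedPerm-cong f≗g i j = cong (λ (s , i′) → signℤ s * δ i′ j) (f≗g i)

signedPerm-isSignedPerm : ∀ {n} (f g : SignedMap (Fin n)) →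
  (∀ i → proj₂ (f (proj₂ (g i))) ≡ i) → (∀ i → proj₂ (g (proj₂ (f i))) ≡ i) →
  IsSignedPerm (signedPerm f)
signedPerm-isSignedPerm f g f∘g≗id g∘f≗id =
  permutation (proj₂ ∘ f) (proj₂ ∘ g) f∘g≗id g∘f≗id , proj₁ ∘ f , λ _ _ → refl

signedPerm-· : ∀ {n} f (N : Mat n) i j →
               (signedPerm f · N) i j ≡ signℤ (proj₁ (f i)) * N (proj₂ (f i)) j
signedPerm-· f N i j = begin
  Σℤ (λ l → s * δ i′ l * N l j)    ≡⟨ Σℤ-cong (λ l → ℤ.*-assoc s (δ i′ l) (N l j)) ⟩
  Σℤ (λ l → s * (δ i′ l * N l j))  ≡⟨ Σℤ-*ˡ s (λ l → δ i′ l * N l j) ⟩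
  s * Σℤ (λ l → δ i′ l * N l j)    ≡⟨ cong (s *_) (Σℤ-δ i′ (λ l → N l j)) ⟩
  s * N i′ j                       ∎
  where
  open ≡-Reasoning
  s = signℤ (proj₁ (f i))
  i′ = proj₂ (f i)

·-signedPermᵀ : ∀ {n} (M : Mat n) f i j →
                (M · signedPerm f ᵀ) i j ≡ M i (proj₂ (f j)) * signℤ (proj₁ (f j))
·-signedPermᵀ M f i j = begin
  Σℤ (λ l → M i l * signedPerm f j l)  ≡⟨ Σℤ-cong (λ l → ℤ.*-comm (M i l) (signedPerm f j l)) ⟩
  (signedPerm f · M ᵀ) j i             ≡⟨ signedPerm-· f (M ᵀ) j i ⟩
  s * M i j′                           ≡⟨ ℤ.*-comm s (M i j′) ⟩
  M i j′ * s                           ∎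
  where
  open ≡-Reasoning
  s = signℤ (proj₁ (f j))
  j′ = proj₂ (f j)

signedPerm-⨟ : ∀ {n} (f g : SignedMap (Fin n)) →
               signedPerm f · signedPerm g ≋ signedPerm (f ⨟ g)
signedPerm-⨟ f g i j = begin
  (signedPerm f · signedPerm g) i j  ≡⟨ signedPerm-· f (signedPerm g) i j ⟩
  s * (t * δ i″ j)                   ≡⟨ ℤ.*-assoc s t (δ i″ j) ⟨
  s * t * δ i″ j                     ≡⟨ cong (_* δ i″ j) (signℤ-* (proj₁ (f i)) (proj₁ (g i′))) ⟨
  signedPerm (f ⨟ g) i j             ∎
  where
  open ≡-Reasoning
  i′ = proj₂ (f i)
  i″ = proj₂ (g i′)
  s = signℤ (proj₁ (f i))
  t = signℤ (proj₁ (g i′))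

signedPerm-cancelˡ : ∀ {n} (f g : SignedMap (Fin n)) → (∀ i → proj₂ (f (proj₂ (g i))) ≡ i) →
  {Y Y′ : Mat n} → signedPerm f · Y ≋ signedPerm f · Y′ → Y ≋ Y′
signedPerm-cancelˡ f g f∘g≗id {Y} {Y′} fY≋fY′ i j = begin
  Y i j    ≡⟨ cong (λ i → Y i j) (f∘g≗id i) ⟨
  Y l′ j   ≡⟨ signℤ-cancelˡ (proj₁ (f l)) (begin
    signℤ (proj₁ (f l)) * Y l′ j   ≡⟨ signedPerm-· f Y l j ⟨
    (signedPerm f · Y) l j         ≡⟨ fY≋fY′ l j ⟩
    (signedPerm f · Y′) l j        ≡⟨ signedPerm-· f Y′ l j ⟩
    signℤ (proj₁ (f l)) * Y′ l′ j  ∎) ⟩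
  Y′ l′ j  ≡⟨ cong (λ i → Y′ i j) (f∘g≗id i) ⟩
  Y′ i j   ∎
  where
  open ≡-Reasoning
  l = proj₂ (g i)
  l′ = proj₂ (f l)

Invariant⇒conj-fixed : ∀ {n} {H : Mat n} f g → Invariant H f g →
                       signedPerm f · H · signedPerm g ᵀ ≋ H
Invariant⇒conj-fixed {H = H} f g inv i j =
  trans (·-signedPermᵀ (signedPerm f · H) g i j)
        (trans (cong (_* signℤ (proj₁ (g j))) (signedPerm-· f H i (proj₂ (g j)))) (inv i j))

·-cong : ∀ {n} {M M′ N N′ : Mat n} → M ≋ M′ → N ≋ N′ → M · N ≋ M′ · N′
·-cong M≋M′ N≋N′ i j = Σℤ-cong (λ l → cong₂ _*_ (M≋M′ i l) (N≋N′ l j))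

≈P-refl : ∀ {n} {x : MPair n} → x ≈P x
≈P-refl = (λ _ _ → refl) , (λ _ _ → refl)

≈P-sym : ∀ {n} {x y : MPair n} → x ≈P y → y ≈P x
≈P-sym (R≋ , S≋) = (λ i j → sym (R≋ i j)) , (λ i j → sym (S≋ i j))

≈P-trans : ∀ {n} {x y z : MPair n} → x ≈P y → y ≈P z → x ≈P z
≈P-trans (R≋ , S≋) (R≋′ , S≋′) =
  (λ i j → trans (R≋ i j) (R≋′ i j)) , (λ i j → trans (S≋ i j) (S≋′ i j))

≈P-setoid : ℕ → Setoid 0ℓ 0ℓ
≈P-setoid n = record
  { Carrier       = MPair n
  ; _≈_           = _≈P_
  ; isEquivalence = record { refl = ≈P-refl ; sym = ≈P-sym ; trans = ≈P-trans }
  }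

⊙-cong : ∀ {n} {x x′ y y′ : MPair n} → x ≈P x′ → y ≈P y′ → x ⊙ y ≈P x′ ⊙ y′
⊙-cong (R≋ , S≋) (R≋′ , S≋′) = ·-cong R≋ R≋′ , ·-cong S≋ S≋′

InAut-resp : ∀ {n} {H : Mat n} {x y} → InAut H x → x ≈P y → InAut H y
InAut-resp ((π , s , R≡) , (π′ , s′ , S≡) , RHSᵀ≋H) (R≋ , S≋) =
  (π , s , λ i j → trans (sym (R≋ i j)) (R≡ i j)) ,
  (π′ , s′ , λ i j → trans (sym (S≋ i j)) (S≡ i j)) ,
  λ i j → trans (sym (·-cong (·-cong R≋ (λ _ _ → refl)) (λ i j → S≋ j i) i j)) (RHSᵀ≋H i j)

Idx : ℕ → Set
Idx k = Fin 4 ⊎ (Fin 4 × Fin (2 ℕ.* k))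

encode : ∀ k → Idx k → Fin (ord k)
encode k (inj₁ p)       = p ↑ˡ _
encode k (inj₂ (p , u)) = 4 ↑ʳ combine p u

decode-encode : ∀ k x → decode k (encode k x) ≡ x
decode-encode k (inj₁ p) rewrite F.splitAt-↑ˡ 4 p (4 ℕ.* (2 ℕ.* k)) = refl
decode-encode k (inj₂ (p , u)) = cong inj₂ (F.remQuot-combine p u)

encode-decode : ∀ k i → encode k (decode k i) ≡ i
encode-decode k i with splitAt 4 i in eq
... | inj₁ p = F.splitAt⁻¹-↑ˡ eq
... | inj₂ c = trans (cong (4 ↑ʳ_) (F.combine-remQuot {4} (2 ℕ.* k) c)) (F.splitAt⁻¹-↑ʳ eq)

diag2-↑ˡ : ∀ {a b} (X : Mat a) (Y : Mat b) p q → diag2 X Y (p ↑ˡ b) (q ↑ˡ b) ≡ X p q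
diag2-↑ˡ {a} {b} X Y p q rewrite F.splitAt-↑ˡ a p b | F.splitAt-↑ˡ a q b = refl

diag2-↑ʳ : ∀ {a b} (X : Mat a) (Y : Mat b) p q → diag2 X Y (a ↑ʳ p) (a ↑ʳ q) ≡ Y p q
diag2-↑ʳ {a} {b} X Y p q rewrite F.splitAt-↑ʳ a b p | F.splitAt-↑ʳ a b q = refl

diag2-↑ˡ-↑ʳ : ∀ {a b} (X : Mat a) (Y : Mat b) p q → diag2 X Y (p ↑ˡ b) (a ↑ʳ q) ≡ + 0
diag2-↑ˡ-↑ʳ {a} {b} X Y p q rewrite F.splitAt-↑ˡ a p b | F.splitAt-↑ʳ a b q = refl

diag2-↑ʳ-↑ˡ : ∀ {a b} (X : Mat a) (Y : Mat b) p q → diag2 X Y (a ↑ʳ p) (q ↑ˡ b) ≡ + 0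
diag2-↑ʳ-↑ˡ {a} {b} X Y p q rewrite F.splitAt-↑ʳ a b p | F.splitAt-↑ˡ a q b = refl

⊗-combine : ∀ {m n} (X : Mat m) (Y : Mat n) p q u v →
            (X ⊗ Y) (combine p u) (combine q v) ≡ X p q * Y u v
⊗-combine {n = n} X Y p q u v =
  cong₂ (λ i j → X (proj₁ i) (proj₁ j) * Y (proj₂ i) (proj₂ j))
        (F.remQuot-combine {k = n} p u) (F.remQuot-combine {k = n} q v)

SignedPerm₄ : Set
SignedPerm₄ = Vec (Sign × Fin 4) 4

toMat₄ : SignedPerm₄ → Mat 4
toMat₄ v = signedPerm (lookup v)

infixl 7 _⨾₄_
_⨾₄_ : SignedPerm₄ → SignedPerm₄ → SignedPerm₄
v ⨾₄ w = tabulate (lookup v ⨟ lookup w)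

scalar₄ : Sign → SignedPerm₄
scalar₄ s = tabulate (s ,_)

BlockPerm : Set
BlockPerm = SignedPerm₄ × SignedPerm₄

infixl 7 _⨾ᵇ_
_⨾ᵇ_ : BlockPerm → BlockPerm → BlockPerm
(β , γ) ⨾ᵇ (β′ , γ′) = β ⨾₄ β′ , γ ⨾₄ γ′

scalarᵇ : Sign → BlockPerm
scalarᵇ s = scalar₄ s , scalar₄ s

act : ∀ k → BlockPerm → SignedMap (Idx k)
act k (β , γ) (inj₁ p)       = Product.map₂ inj₁ (lookup β p)
act k (β , γ) (inj₂ (p , u)) = Product.map₂ (λ q → inj₂ (q , u)) (lookup γ p)

act-⨾ : ∀ k b b′ x → act k (b ⨾ᵇ b′) x ≡ (act k b ⨟ act k b′) x
act-⨾ k (β , γ) (β′ , γ′) (inj₁ p)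
  rewrite Vec.lookup∘tabulate (lookup β ⨟ lookup β′) p = refl
act-⨾ k (β , γ) (β′ , γ′) (inj₂ (p , u))
  rewrite Vec.lookup∘tabulate (lookup γ ⨟ lookup γ′) p = refl

act-scalar : ∀ k s x → act k (scalarᵇ s) x ≡ (s , x)
act-scalar k s (inj₁ p)       rewrite Vec.lookup∘tabulate (s ,_) p = refl
act-scalar k s (inj₂ (p , u)) rewrite Vec.lookup∘tabulate (s ,_) p = refl

blockAct : ∀ k → BlockPerm → SignedMap (Fin (ord k))
blockAct k b i = Product.map₂ (encode k) (act k b (decode k i))

blockMat : ∀ k → BlockPerm → Mat (ord k)
blockMat k b = signedPerm (blockAct k b)

blockAct-⨾ : ∀ k b b′ i → blockAct k (b ⨾ᵇ b′) i ≡ (blockAct k b ⨟ blockAct k b′) i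
blockAct-⨾ k b b′ i rewrite decode-encode k (proj₂ (act k b (decode k i))) =
  cong (Product.map₂ (encode k)) (act-⨾ k b b′ (decode k i))

blockAct-scalar : ∀ k s i → blockAct k (scalarᵇ s) i ≡ (s , i)
blockAct-scalar k s i rewrite act-scalar k s (decode k i) = cong (s ,_) (encode-decode k i)

blockAct-inverse : ∀ k {b b′} → b′ ⨾ᵇ b ≡ scalarᵇ Sign.+ →
                   ∀ i → proj₂ (blockAct k b (proj₂ (blockAct k b′ i))) ≡ i
blockAct-inverse k {b} {b′} b′⨾b≡1 i = cong proj₂ (begin
  (blockAct k b′ ⨟ blockAct k b) i  ≡⟨ blockAct-⨾ k b′ b i ⟨
  blockAct k (b′ ⨾ᵇ b) i           ≡⟨ cong (λ c → blockAct k c i) b′⨾b≡1 ⟩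
  blockAct k (scalarᵇ Sign.+) i    ≡⟨ blockAct-scalar k Sign.+ i ⟩
  (Sign.+ , i)                     ∎)
  where open ≡-Reasoning

blockMat-⨾ : ∀ k b b′ → blockMat k b · blockMat k b′ ≋ blockMat k (b ⨾ᵇ b′)
blockMat-⨾ k b b′ i j =
  trans (signedPerm-⨟ (blockAct k b) (blockAct k b′) i j)
        (signedPerm-cong (sym ∘ blockAct-⨾ k b b′) i j)

blockMat-scalar : ∀ k s → blockMat k (scalarᵇ s) ≋ signedPerm (s ,_)
blockMat-scalar k s = signedPerm-cong (blockAct-scalar k s)

blockMat-isSignedPerm : ∀ k {b b′} → b ⨾ᵇ b′ ≡ scalarᵇ Sign.+ → b′ ⨾ᵇ b ≡ scalarᵇ Sign.+ →
                        IsSignedPerm (blockMat k b)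
blockMat-isSignedPerm k {b} {b′} b⨾b′≡1 b′⨾b≡1 =
  signedPerm-isSignedPerm (blockAct k b) (blockAct k b′)
                          (blockAct-inverse k b′⨾b≡1) (blockAct-inverse k b⨾b′≡1)

blockMat-cancelˡ : ∀ k {b b′} → b′ ⨾ᵇ b ≡ scalarᵇ Sign.+ → {Y Y′ : Mat (ord k)} →
                   blockMat k b · Y ≋ blockMat k b · Y′ → Y ≋ Y′
blockMat-cancelˡ k {b} {b′} b′⨾b≡1 =
  signedPerm-cancelˡ (blockAct k b) (blockAct k b′) (blockAct-inverse k b′⨾b≡1)

blockMat-encode : ∀ k b x j → blockMat k b (encode k x) j ≡
                  signℤ (proj₁ (act k b x)) * δ (encode k (proj₂ (act k b x))) j
blockMat-encode k b x j rewrite decode-encode k x = refl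

module _ (k : ℕ) {X Y : Mat 4} {β γ : SignedPerm₄} (X≋β : X ≋ toMat₄ β) (Y≋γ : Y ≋ toMat₄ γ)
  where
  private
    n : ℕ
    n = 4 ℕ.* (2 ℕ.* k)
    Yᵏ : Mat n
    Yᵏ = Y ⊗ Id (2 ℕ.* k)
    open ≡-Reasoning

  blockAut-encode : ∀ x y → blockAut k X Y (encode k x) (encode k y) ≡
    signℤ (proj₁ (act k (β , γ) x)) * δ (encode k (proj₂ (act k (β , γ) x))) (encode k y)
  blockAut-encode (inj₁ p) (inj₁ q) = begin
    diag2 X Yᵏ (p ↑ˡ n) (q ↑ˡ n)  ≡⟨ diag2-↑ˡ X Yᵏ p q ⟩
    X p q                         ≡⟨ X≋β p q ⟩
    s * δ p′ q                    ≡⟨ cong (s *_) (δ-injective (_↑ˡ n) ↑ˡ-injective p′ q) ⟨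
    s * δ (p′ ↑ˡ n) (q ↑ˡ n)      ∎
    where
    s = signℤ (proj₁ (lookup β p))
    p′ = proj₂ (lookup β p)
    ↑ˡ-injective : ∀ {a b : Fin 4} → a ↑ˡ n ≡ b ↑ˡ n → a ≡ b
    ↑ˡ-injective = F.↑ˡ-injective n _ _
  blockAut-encode (inj₁ p) (inj₂ (q , v)) = begin
    diag2 X Yᵏ (p ↑ˡ n) (4 ↑ʳ combine q v)  ≡⟨ diag2-↑ˡ-↑ʳ X Yᵏ p (combine q v) ⟩
    + 0                                    ≡⟨ ℤ.*-zeroʳ s ⟨
    s * + 0                                ≡⟨ cong (s *_) (δ-↑ˡ-↑ʳ p′ (combine q v)) ⟨
    s * δ (p′ ↑ˡ n) (4 ↑ʳ combine q v)     ∎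
    where
    s = signℤ (proj₁ (lookup β p))
    p′ = proj₂ (lookup β p)
  blockAut-encode (inj₂ (p , u)) (inj₁ q) = begin
    diag2 X Yᵏ (4 ↑ʳ combine p u) (q ↑ˡ n)  ≡⟨ diag2-↑ʳ-↑ˡ X Yᵏ (combine p u) q ⟩
    + 0                                    ≡⟨ ℤ.*-zeroʳ s ⟨
    s * + 0                                ≡⟨ cong (s *_) (δ-↑ʳ-↑ˡ q (combine p′ u)) ⟨
    s * δ (4 ↑ʳ combine p′ u) (q ↑ˡ n)     ∎
    where
    s = signℤ (proj₁ (lookup γ p))
    p′ = proj₂ (lookup γ p)
  blockAut-encode (inj₂ (p , u)) (inj₂ (q , v)) = begin
    diag2 X Yᵏ (4 ↑ʳ combine p u) (4 ↑ʳ combine q v)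
      ≡⟨ diag2-↑ʳ X Yᵏ (combine p u) (combine q v) ⟩
    Yᵏ (combine p u) (combine q v)      ≡⟨ ⊗-combine Y (Id _) p q u v ⟩
    Y p q * δ u v                       ≡⟨ cong (_* δ u v) (Y≋γ p q) ⟩
    s * δ p′ q * δ u v                  ≡⟨ ℤ.*-assoc s (δ p′ q) (δ u v) ⟩
    s * (δ p′ q * δ u v)                ≡⟨ cong (s *_) (δ-combine p′ q u v) ⟨
    s * δ (combine p′ u) (combine q v)  ∎
    where
    s = signℤ (proj₁ (lookup γ p))
    p′ = proj₂ (lookup γ p)

  blockAut-blockMat : blockAut k X Y ≋ blockMat k (β , γ)
  blockAut-blockMat i j = begin
    blockAut k X Y i j
      ≡⟨ cong₂ (blockAut k X Y) (encode-decode k i) (encode-decode k j) ⟨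
    blockAut k X Y (encode k x) (encode k y)
      ≡⟨ blockAut-encode x y ⟩
    signℤ (proj₁ (act k (β , γ) x)) * δ (encode k (proj₂ (act k (β , γ) x))) (encode k y)
      ≡⟨ blockMat-encode k (β , γ) x (encode k y) ⟨
    blockMat k (β , γ) (encode k x) (encode k y)
      ≡⟨ cong₂ (blockMat k (β , γ)) (encode-decode k i) (encode-decode k j) ⟩
    blockMat k (β , γ) i j ∎
    where
    x = decode k i
    y = decode k j

blockLetter : Fin 4 → Fin 4 → Fin 4
blockLetter p q = lookup (lookup blkLetter p) q

kimuraPattern : ∀ k → (Fin 4 → Mat (2 ℕ.* k)) → Idx k → Idx k → ℤ
kimuraPattern k M (inj₁ p)       (inj₁ q)       = Tkim p q
kimuraPattern k M (inj₁ p)       (inj₂ (q , _)) = Ukim p q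
kimuraPattern k M (inj₂ (p , _)) (inj₁ q)       = Vkim p q
kimuraPattern k M (inj₂ (p , u)) (inj₂ (q , v)) = blkSign p q * M (blockLetter p q) u v

kimuraBlocks : ∀ k → (a b c d : Dih k → Bool) → Fin 4 → Mat (2 ℕ.* k)
kimuraBlocks k a b c d = lookup (pmMat k a ∷ pmMat k b ∷ pmMat k c ∷ pmMat k d ∷ [])

kimura-decode : ∀ k a b c d i j →
  kimura k a b c d i j ≡ kimuraPattern k (kimuraBlocks k a b c d) (decode k i) (decode k j)
kimura-decode k a b c d i j with decode k i | decode k j
... | inj₁ _ | inj₁ _ = refl
... | inj₁ _ | inj₂ _ = refl
... | inj₂ _ | inj₁ _ = refl
... | inj₂ _ | inj₂ _ = refl

BlockPair : Set
BlockPair = BlockPerm × BlockPerm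

PreservesPattern : BlockPair → Set
PreservesPattern ((βR , γR) , (βS , γS)) =
  Invariant Tkim (lookup βR) (lookup βS) ×
  Invariant Ukim (lookup βR) (lookup γS) ×
  Invariant Vkim (lookup γR) (lookup βS) ×
  Invariant blkSign (lookup γR) (lookup γS) ×
  (∀ p q → blockLetter (proj₂ (lookup γR p)) (proj₂ (lookup γS q)) ≡ blockLetter p q)

preservesPattern? : ∀ b → Dec (PreservesPattern b)
preservesPattern? ((βR , γR) , (βS , γS)) =
  invariant? Tkim (lookup βR) (lookup βS) ×-dec
  invariant? Ukim (lookup βR) (lookup γS) ×-dec
  invariant? Vkim (lookup γR) (lookup βS) ×-dec
  invariant? blkSign (lookup γR) (lookup γS) ×-dec
  F.all? λ p → F.all? λ q →
    blockLetter (proj₂ (lookup γR p)) (proj₂ (lookup γS q)) F.≟ blockLetter p q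
  where
  invariant? : (M : Mat 4) → ∀ f g → Dec (Invariant M f g)
  invariant? M f g = F.all? λ i → F.all? λ j → _ ℤ.≟ M i j

kimuraPattern-invariant : ∀ k M {bR bS} → PreservesPattern (bR , bS) →
                          Invariant (kimuraPattern k M) (act k bR) (act k bS)
kimuraPattern-invariant k M (T , _)         (inj₁ p)       (inj₁ q)       = T p q
kimuraPattern-invariant k M (_ , U , _)     (inj₁ p)       (inj₂ (q , _)) = U p q
kimuraPattern-invariant k M (_ , _ , V , _) (inj₂ (p , _)) (inj₁ q)       = V p q
kimuraPattern-invariant k M {_ , γR} {_ , γS} (_ , _ , _ , signs , letters)
                        (inj₂ (p , u)) (inj₂ (q , v)) =
  trans (rearrange s (blkSign p′ q′) t (M (blockLetter p′ q′) u v))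
        (cong₂ _*_ (signs p q) (cong (λ l → M l u v) (letters p q)))
  where
  s = signℤ (proj₁ (lookup γR p))
  t = signℤ (proj₁ (lookup γS q))
  p′ = proj₂ (lookup γR p)
  q′ = proj₂ (lookup γS q)
  rearrange : ∀ s e t m → s * (e * m) * t ≡ s * e * t * m
  rearrange = solve-∀

kimura-invariant : ∀ k a b c d {bR bS} → PreservesPattern (bR , bS) →
                   Invariant (kimura k a b c d) (blockAct k bR) (blockAct k bS)
kimura-invariant k a b c d {bR} {bS} pres i j = begin
  s * H (encode k x′) (encode k y′) * t
    ≡⟨ cong (λ h → s * h * t) (kimura-decode k a b c d (encode k x′) (encode k y′)) ⟩
  s * K (decode k (encode k x′)) (decode k (encode k y′)) * t
    ≡⟨ cong₂ (λ x y → s * K x y * t) (decode-encode k x′) (decode-encode k y′) ⟩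
  s * K x′ y′ * t
    ≡⟨ kimuraPattern-invariant k (kimuraBlocks k a b c d) pres (decode k i) (decode k j) ⟩
  K (decode k i) (decode k j)
    ≡⟨ kimura-decode k a b c d i j ⟨
  H i j ∎
  where
  open ≡-Reasoning
  H = kimura k a b c d
  K = kimuraPattern k (kimuraBlocks k a b c d)
  s = signℤ (proj₁ (act k bR (decode k i)))
  t = signℤ (proj₁ (act k bS (decode k j)))
  x′ = proj₂ (act k bR (decode k i))
  y′ = proj₂ (act k bS (decode k j))

1Q : Q₈
1Q = Sign.+ , q1

infix 30 _⁻¹Q
_⁻¹Q : Q₈ → Q₈
(s , q1) ⁻¹Q = s , q1
(s , q)  ⁻¹Q = Sign.opposite s , q

_^Q_ : Q₈ → ℕ → Q₈
x ^Q zero  = 1Q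
x ^Q suc m = x *Q (x ^Q m)

_≟ᵇ_ : DecidableEquality QBasis
q1 ≟ᵇ q1 = yes refl
q1 ≟ᵇ qi = no λ ()
q1 ≟ᵇ qj = no λ ()
q1 ≟ᵇ qk = no λ ()
qi ≟ᵇ q1 = no λ ()
qi ≟ᵇ qi = yes refl
qi ≟ᵇ qj = no λ ()
qi ≟ᵇ qk = no λ ()
qj ≟ᵇ q1 = no λ ()
qj ≟ᵇ qi = no λ ()
qj ≟ᵇ qj = yes refl
qj ≟ᵇ qk = no λ ()
qk ≟ᵇ q1 = no λ ()
qk ≟ᵇ qi = no λ ()
qk ≟ᵇ qj = no λ ()
qk ≟ᵇ qk = yes refl

infix 4 _≟Q_
_≟Q_ : DecidableEquality Q₈
_≟Q_ = Product.≡-dec Sign._≟_ _≟ᵇ_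

∀-Sign? : {P : Sign → Set} → (∀ s → Dec (P s)) → Dec (∀ s → P s)
∀-Sign? P? = map′ (λ (p₊ , p₋) → λ { Sign.+ → p₊ ; Sign.- → p₋ }) (λ p → p Sign.+ , p Sign.-)
                  (P? Sign.+ ×-dec P? Sign.-)

∀-QBasis? : {P : QBasis → Set} → (∀ q → Dec (P q)) → Dec (∀ q → P q)
∀-QBasis? P? = map′ (λ (p₁ , pᵢ , pⱼ , pₖ) → λ { q1 → p₁ ; qi → pᵢ ; qj → pⱼ ; qk → pₖ })
                    (λ p → p q1 , p qi , p qj , p qk)
                    (P? q1 ×-dec P? qi ×-dec P? qj ×-dec P? qk)

∀-Q₈? : {P : Q₈ → Set} → (∀ x → Dec (P x)) → Dec (∀ x → P x)
∀-Q₈? P? = map′ (λ p (s , q) → p s q) (λ p s q → p (s , q))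
                (∀-Sign? λ s → ∀-QBasis? λ q → P? (s , q))

*Q-inverseˡ : ∀ x → x ⁻¹Q *Q x ≡ 1Q
*Q-inverseˡ = toWitness {a? = ∀-Q₈? λ x → x ⁻¹Q *Q x ≟Q 1Q} _

*Q-inverseʳ : ∀ x → x *Q x ⁻¹Q ≡ 1Q
*Q-inverseʳ = toWitness {a? = ∀-Q₈? λ x → x *Q x ⁻¹Q ≟Q 1Q} _

HasOrderQ : Q₈ → ℕ → Set
HasOrderQ x m = x ^Q m ≡ 1Q × (∀ j → 0 < j → j < m → x ^Q j ≢ 1Q)

qi-order : HasOrderQ (Sign.+ , qi) 4
qi-order = refl , λ { 1 _ _ () ; 2 _ _ () ; 3 _ _ ()
                    ; (suc (suc (suc (suc _)))) _ (s≤s (s≤s (s≤s (s≤s ())))) }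

qj-order : HasOrderQ (Sign.+ , qj) 4
qj-order = refl , λ { 1 _ _ () ; 2 _ _ () ; 3 _ _ ()
                    ; (suc (suc (suc (suc _)))) _ (s≤s (s≤s (s≤s (s≤s ())))) }

infixl 7 _⨾ᵖ_
_⨾ᵖ_ : BlockPair → BlockPair → BlockPair
(bR , bS) ⨾ᵖ (bR′ , bS′) = bR ⨾ᵇ bR′ , bS ⨾ᵇ bS′

scalarᵖ : Sign → BlockPair
scalarᵖ s = scalarᵇ s , scalarᵇ s

infix 4 _≟ᵖ_
_≟ᵖ_ : DecidableEquality BlockPair
_≟ᵖ_ = Product.≡-dec _≟ᵇᵖ_ _≟ᵇᵖ_
  where
  _≟₄_ : DecidableEquality SignedPerm₄
  _≟₄_ = Vec.≡-dec (Product.≡-dec Sign._≟_ F._≟_)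
  _≟ᵇᵖ_ : DecidableEquality BlockPerm
  _≟ᵇᵖ_ = Product.≡-dec _≟₄_ _≟₄_

diag± : Sign → Sign → Sign → Sign → (Fin 4 → Fin 4) → SignedPerm₄
diag± s₀ s₁ s₂ s₃ f = Vec.zip (s₀ ∷ s₁ ∷ s₂ ∷ s₃ ∷ []) (tabulate f)

-- ψ₊ qi and ψ₊ qj transcribe (R₁ , S₁) and (R₂ , S₂): diag(d) P is diag± d applied to the
-- permutation of P, and bdiag(d) is diag± d F.opposite.
ψ₊ : QBasis → BlockPair
ψ₊ q1 = scalarᵖ Sign.+
ψ₊ qi = (diag± Sign.- Sign.+ Sign.- Sign.+ F.opposite , diag± Sign.- Sign.+ Sign.- Sign.+ perm₁) ,
        (diag± Sign.+ Sign.- Sign.- Sign.+ perm₂      , diag± Sign.- Sign.+ Sign.+ Sign.- perm₁)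
ψ₊ qj = (diag± Sign.- Sign.+ Sign.+ Sign.- perm₁      , diag± Sign.+ Sign.- Sign.- Sign.+ perm₂) ,
        (diag± Sign.+ Sign.+ Sign.- Sign.- F.opposite , diag± Sign.+ Sign.+ Sign.- Sign.- perm₂)
ψ₊ qk = ψ₊ qi ⨾ᵖ ψ₊ qj

ψ : Q₈ → BlockPair
ψ (s , q) = scalarᵖ s ⨾ᵖ ψ₊ q

ψ-hom : ∀ x y → ψ (x *Q y) ≡ ψ x ⨾ᵖ ψ y
ψ-hom = toWitness {a? = ∀-Q₈? λ x → ∀-Q₈? λ y → ψ (x *Q y) ≟ᵖ ψ x ⨾ᵖ ψ y} _

ψ-preservesPattern : ∀ x → PreservesPattern (ψ x)
ψ-preservesPattern = toWitness {a? = ∀-Q₈? (preservesPattern? ∘ ψ)} _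

ψ-inverseˡ : ∀ x → ψ (x ⁻¹Q) ⨾ᵖ ψ x ≡ scalarᵖ Sign.+
ψ-inverseˡ x = trans (sym (ψ-hom (x ⁻¹Q) x)) (cong ψ (*Q-inverseˡ x))

ψ-inverseʳ : ∀ x → ψ x ⨾ᵖ ψ (x ⁻¹Q) ≡ scalarᵖ Sign.+
ψ-inverseʳ x = trans (sym (ψ-hom x (x ⁻¹Q))) (cong ψ (*Q-inverseʳ x))

pairMat : ∀ k → BlockPair → MPair (ord k)
pairMat k (bR , bS) = blockMat k bR , blockMat k bS

pairMat-⨾ : ∀ k b b′ → pairMat k b ⊙ pairMat k b′ ≈P pairMat k (b ⨾ᵖ b′)
pairMat-⨾ k (bR , bS) (bR′ , bS′) = blockMat-⨾ k bR bR′ , blockMat-⨾ k bS bS′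

pairMat-scalar : ∀ k s → pairMat k (scalarᵖ s) ≈P (signedPerm (s ,_) , signedPerm (s ,_))
pairMat-scalar k s = blockMat-scalar k s , blockMat-scalar k s

φ : ∀ k → Q₈ → MPair (ord k)
φ k x = pairMat k (ψ x)

φ-hom : ∀ k x y → φ k (x *Q y) ≈P φ k x ⊙ φ k y
φ-hom k x y =
  subst (λ b → pairMat k b ≈P φ k x ⊙ φ k y) (sym (ψ-hom x y)) (≈P-sym (pairMat-⨾ k (ψ x) (ψ y)))

φ-1 : ∀ k → φ k 1Q ≈P εP (ord k)
φ-1 k = ≈P-trans (pairMat-scalar k Sign.+) (+I≋I , +I≋I)
  where
  +I≋I : signedPerm (Sign.+ ,_) ≋ Id (ord k)
  +I≋I i j = ℤ.*-identityˡ (δ i j)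

φ-−1 : ∀ k → φ k (Sign.- , q1) ≈P negIPair k
φ-−1 k = ≈P-trans (pairMat-scalar k Sign.-) (-I≋-I , -I≋-I)
  where
  -I≋-I : signedPerm (Sign.- ,_) ≋ negM (Id (ord k))
  -I≋-I i j = ℤ.-1*i≡-i (δ i j)

φ-cancelˡ : ∀ k x {y y′} → φ k x ⊙ y ≈P φ k x ⊙ y′ → y ≈P y′
φ-cancelˡ k x (R≋ , S≋) =
  blockMat-cancelˡ k {b′ = proj₁ (ψ (x ⁻¹Q))} (cong proj₁ (ψ-inverseˡ x)) R≋ ,
  blockMat-cancelˡ k {b′ = proj₂ (ψ (x ⁻¹Q))} (cong proj₂ (ψ-inverseˡ x)) S≋

φ-aut : ∀ k a b c d x → InAut (kimura k a b c d) (φ k x)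
φ-aut k a b c d x =
  blockMat-isSignedPerm k {b′ = proj₁ (ψ (x ⁻¹Q))}
                        (cong proj₁ (ψ-inverseʳ x)) (cong proj₁ (ψ-inverseˡ x)) ,
  blockMat-isSignedPerm k {b′ = proj₂ (ψ (x ⁻¹Q))}
                        (cong proj₂ (ψ-inverseʳ x)) (cong proj₂ (ψ-inverseˡ x)) ,
  Invariant⇒conj-fixed (blockAct k _) (blockAct k _)
                       (kimura-invariant k a b c d (ψ-preservesPattern x))

headerRow : ∀ k → MPair (ord k) → Vec ℤ 4
headerRow k (R , _) = tabulate (λ q → R zero (q ↑ˡ _))

-- The eight images already differ on the first header row, whatever k is, so the check below
-- runs with k a variable.
headerRow-φ-injective : ∀ k x y → headerRow k (φ k x) ≡ headerRow k (φ k y) → x ≡ y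
headerRow-φ-injective k = toWitness {a? = ∀-Q₈? λ x → ∀-Q₈? λ y →
  Vec.≡-dec ℤ._≟_ (headerRow k (φ k x)) (headerRow k (φ k y)) →-dec x ≟Q y} _

φ-injective : ∀ k x y → φ k x ≈P φ k y → x ≡ y
φ-injective k x y (R≋ , _) =
  headerRow-φ-injective k x y (Vec.tabulate-cong (λ q → R≋ zero (q ↑ˡ _)))

toMat₄? : ∀ X v → Dec (X ≋ toMat₄ v)
toMat₄? X v = F.all? λ p → F.all? λ q → X p q ℤ.≟ toMat₄ v p q

blockAut-blockMat-by-check : ∀ k X Y b → True (toMat₄? X (proj₁ b)) → True (toMat₄? Y (proj₂ b)) →
                             blockAut k X Y ≋ blockMat k b
blockAut-blockMat-by-check k X Y b X≋ Y≋ = blockAut-blockMat k (toWitness X≋) (toWitness Y≋)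

σ₃≈φ : ∀ k → σ₃ k ≈P φ k (Sign.+ , qi)
σ₃≈φ k =
  blockAut-blockMat-by-check k (bdiag4 m1 p1 m1 p1) (diag4 m1 p1 m1 p1 · P₁)
                             (proj₁ (ψ (Sign.+ , qi))) _ _ ,
  blockAut-blockMat-by-check k (diag4 p1 m1 m1 p1 · P₂) (diag4 m1 p1 p1 m1 · P₁)
                             (proj₂ (ψ (Sign.+ , qi))) _ _

σ₄≈φ : ∀ k → σ₄ k ≈P φ k (Sign.+ , qj)
σ₄≈φ k =
  blockAut-blockMat-by-check k (diag4 m1 p1 p1 m1 · P₁) (diag4 p1 m1 m1 p1 · P₂)
                             (proj₁ (ψ (Sign.+ , qj))) _ _ ,
  blockAut-blockMat-by-check k (bdiag4 p1 p1 m1 m1) (diag4 p1 p1 m1 m1 · P₂)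
                             (proj₂ (ψ (Sign.+ , qj))) _ _

module _ (k : ℕ) where
  private
    G : MPair (ord k) → Set
    G = Gen (σ₃ k) (σ₄ k)

  φ-*∈Gen : ∀ x y → G (φ k x) → G (φ k y) → G (φ k (x *Q y))
  φ-*∈Gen x y gx gy = gen-resp (gen-mul gx gy) (≈P-sym (φ-hom k x y))

  φ₊∈Gen : ∀ q → G (φ k (Sign.+ , q))
  φ₊∈Gen q1 = gen-resp gen-ε (≈P-sym (φ-1 k))
  φ₊∈Gen qi = gen-resp gen-g₁ (σ₃≈φ k)
  φ₊∈Gen qj = gen-resp gen-g₂ (σ₄≈φ k)
  φ₊∈Gen qk = φ-*∈Gen (Sign.+ , qi) (Sign.+ , qj) (φ₊∈Gen qi) (φ₊∈Gen qj)

  φ∈Gen : ∀ x → G (φ k x)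
  φ∈Gen (Sign.+ , q) = φ₊∈Gen q
  φ∈Gen (Sign.- , q) =
    φ-*∈Gen (Sign.- , q1) (Sign.+ , q)
            (φ-*∈Gen (Sign.+ , qi) (Sign.+ , qi) (φ₊∈Gen qi) (φ₊∈Gen qi)) (φ₊∈Gen q)

  Gen⊆image-φ : ∀ {z} → G z → ∃ λ x → φ k x ≈P z
  Gen⊆image-φ gen-ε  = 1Q , φ-1 k
  Gen⊆image-φ gen-g₁ = (Sign.+ , qi) , ≈P-sym (σ₃≈φ k)
  Gen⊆image-φ gen-g₂ = (Sign.+ , qj) , ≈P-sym (σ₄≈φ k)
  Gen⊆image-φ (gen-mul g h) with Gen⊆image-φ g | Gen⊆image-φ h
  ... | x , φx≈ | y , φy≈ = x *Q y , ≈P-trans (φ-hom k x y) (⊙-cong φx≈ φy≈)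
  Gen⊆image-φ (gen-inv {x = z} {y = y} g z⊙y≈ε) with Gen⊆image-φ g
  ... | x , φx≈z = x ⁻¹Q , φ-cancelˡ k x (begin
    φ k x ⊙ φ k (x ⁻¹Q)  ≈⟨ φ-hom k x (x ⁻¹Q) ⟨
    φ k (x *Q x ⁻¹Q)     ≡⟨ cong (φ k) (*Q-inverseʳ x) ⟩
    φ k 1Q               ≈⟨ φ-1 k ⟩
    εP (ord k)           ≈⟨ z⊙y≈ε ⟨
    z ⊙ y                ≈⟨ ⊙-cong φx≈z (≈P-refl {x = y}) ⟨
    φ k x ⊙ y            ∎)
    where open SetoidReasoning (≈P-setoid (ord k))
  Gen⊆image-φ (gen-resp g z≈z′) with Gen⊆image-φ g
  ... | x , φx≈z = x , ≈P-trans φx≈z z≈z′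

  φ-^ : ∀ {σ x} → σ ≈P φ k x → ∀ m → σ ^P m ≈P φ k (x ^Q m)
  φ-^ σ≈φx zero = ≈P-sym (φ-1 k)
  φ-^ {x = x} σ≈φx (suc m) =
    ≈P-trans (⊙-cong σ≈φx (φ-^ σ≈φx m)) (≈P-sym (φ-hom k x (x ^Q m)))

  φ-hasOrder : ∀ {σ x m} → σ ≈P φ k x → HasOrderQ x m → HasOrder σ m
  φ-hasOrder {σ} {x} {m} σ≈φx (xᵐ≡1 , minimal) =
    ≈P-trans (subst (λ y → σ ^P m ≈P φ k y) xᵐ≡1 (φ-^ σ≈φx m)) (φ-1 k) ,
    λ j 0<j j<m σʲ≈ε → minimal j 0<j j<m
      (φ-injective k _ _ (≈P-trans (≈P-sym (φ-^ σ≈φx j)) (≈P-trans σʲ≈ε (≈P-sym (φ-1 k)))))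

proposition3p2 : (k : ℕ) → 3 ≤ k → Odd k →
    (a b c d : Dih k → Bool) →
    IsHadamardOrder k (kimura k a b c d) →
    InAut (kimura k a b c d) (negIPair k) ×
    InAut (kimura k a b c d) (σ₃ k) ×
    InAut (kimura k a b c d) (σ₄ k) ×
    HasOrder (σ₃ k) 4 ×
    HasOrder (σ₄ k) 4 ×
    (∀ z → Gen (σ₃ k) (σ₄ k) z → InAut (kimura k a b c d) z) ×
    GenIsoQ₈ (σ₃ k) (σ₄ k)
proposition3p2 k _ _ a b c d _ =
  InAut-resp (aut (Sign.- , q1)) (φ-−1 k) ,
  InAut-resp (aut (Sign.+ , qi)) (≈P-sym (σ₃≈φ k)) ,
  InAut-resp (aut (Sign.+ , qj)) (≈P-sym (σ₄≈φ k)) ,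
  φ-hasOrder k (σ₃≈φ k) qi-order ,
  φ-hasOrder k (σ₄≈φ k) qj-order ,
  (λ _ g → let x , φx≈z = Gen⊆image-φ k g in InAut-resp (aut x) φx≈z) ,
  φ k , φ-hom k , φ-injective k , φ∈Gen k , λ _ → Gen⊆image-φ k
  where
  aut : ∀ x → InAut (kimura k a b c d) (φ k x)
  aut = φ-aut k a b c d
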